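{- Let $\mathbf P=(P,\leq,{}',0,1)$ be an orthocomplete atomic orthomodular poset. The following are equivalent: (i) $\mathbf P$ is pseudo-orthomodular; (ii) $\mathbf P$ is a complete orthomodular lattice; (iii) the Dedekind-MacNeille completion $\mathrm{DM}(\mathbf P)$ is orthomodular.
   Context: For $M\subseteq P$, $U(M)$, $L(M)$ denote the sets of upper and lower bounds of $M$. A poset with complementation is a bounded poset with an antitone involution $'$ ($x\leq y\Rightarrow y'\leq x'$, $x''=x$) such that $L(x,x')=\{0\}$, $U(x,x')=\{1\}$. A subset $S$ is orthogonal if $s\leq t'$ for all distinct $s,t\in S$. An orthomodular poset is a poset with complementation in which $x\vee y$ exists whenever $x\leq y'$, and in which $x\leq y$ implies $y=x\vee(y\wedge x')$ (where $y\wedge x'=(y'\vee x)'$). It is orthocomplete if every orthogonal subset has a join in $P$. It is atomic if every element $b>0$ lies above some atom (an element $a>0$ with nothing strictly between $0$ and $a$). It is pseudo-orthomodular if $L(U(L(x,y),y'),y)=L(x,y)$ for all $x,y$. The Dedekind-MacNeille completion $\mathrm{DM}(\mathbf P)$ is the complete lattice $(\{B\subseteq P\mid L(U(B))=B\},\subseteq)$ with $P$ embedded via $x\mapsto L(x)$ and complementation $X\mapsto L(\{x'\mid x\in X\})$; a lattice with complementation is orthomodular if $x\vee y=((x\vee y)\wedge y')\vee y$. -}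

module Defs where

open import Level using (Level; suc; _⊔_)
open import Data.Product using (Σ; ∃; _×_; _,_; proj₁)
open import Data.Sum using (_⊎_)
open import Relation.Nullary using (¬_)
open import Relation.Binary.PropositionalEquality using (_≡_; _≢_)
open import Relation.Binary.Structures using (IsPartialOrder)
open import Relation.Unary using (Pred; _∈_; _⊆_; _≐_; _∪_; _∩_; ｛_｝)

record PosetWithComplementation (ℓ : Level) : Set (suc ℓ) where
  infix 4 _≤_
  infix 8 _′
  field
    Carrier        : Set ℓ
    _≤_            : Carrier → Carrier → Set ℓ
    _′             : Carrier → Carrier
    𝟘 𝟙            : Carrier
    isPartialOrder : IsPartialOrder _≡_ _≤_
    𝟘-least        : ∀ x → 𝟘 ≤ x
    𝟙-greatest     : ∀ x → x ≤ 𝟙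
    antitone       : ∀ {x y} → x ≤ y → y ′ ≤ x ′
    involutive     : ∀ x → (x ′) ′ ≡ x
    lower-compl    : ∀ x z → z ≤ x → z ≤ x ′ → z ≡ 𝟘
    upper-compl    : ∀ x z → x ≤ z → x ′ ≤ z → z ≡ 𝟙

module _ {ℓ : Level} (P : PosetWithComplementation ℓ) where
  open PosetWithComplementation P

  Subset : Set (suc ℓ)
  Subset = Pred Carrier ℓ

  L : Subset → Subset
  L M = λ z → ∀ m → m ∈ M → z ≤ m

  U : Subset → Subset
  U M = λ z → ∀ m → m ∈ M → m ≤ z

  pair : Carrier → Carrier → Subset
  pair x y = ｛ x ｝ ∪ ｛ y ｝

  IsSup : Subset → Carrier → Set ℓ
  IsSup M s = s ∈ U M × (∀ u → u ∈ U M → s ≤ u)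

  IsInf : Subset → Carrier → Set ℓ
  IsInf M i = i ∈ L M × (∀ l → l ∈ L M → l ≤ i)

  IsJoin : Carrier → Carrier → Carrier → Set ℓ
  IsJoin x y j = IsSup (pair x y) j

  IsMeet : Carrier → Carrier → Carrier → Set ℓ
  IsMeet x y m = IsInf (pair x y) m

  -- Orthomodular poset: x ∨ y exists whenever x ≤ y′, and
  -- x ≤ y implies y = x ∨ (y ∧ x′) where y ∧ x′ := (y′ ∨ x)′.
  -- (All joins involved exist by the first clause; the second clause
  --  is stated for the (unique) joins.)
  IsOrthomodularPoset : Set ℓ
  IsOrthomodularPoset =
    (∀ x y → x ≤ y ′ → ∃ λ j → IsJoin x y j)
    × (∀ x y → x ≤ y → ∀ m j → IsJoin (y ′) x m → IsJoin x (m ′) j → y ≡ j)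

  Orthogonal : Subset → Set ℓ
  Orthogonal S = ∀ s t → s ∈ S → t ∈ S → s ≢ t → s ≤ t ′

  Orthocomplete : Set (suc ℓ)
  Orthocomplete = ∀ (S : Subset) → Orthogonal S → ∃ λ s → IsSup S s

  _<_ : Carrier → Carrier → Set ℓ
  x < y = x ≤ y × x ≢ y

  IsAtom : Carrier → Set ℓ
  IsAtom a = 𝟘 < a × ¬ (∃ λ z → 𝟘 < z × z < a)

  Atomic : Set ℓ
  Atomic = ∀ b → 𝟘 < b → ∃ λ a → IsAtom a × a ≤ b

  PseudoOrthomodular : Set ℓ
  PseudoOrthomodular =
    ∀ x y → L (U (L (pair x y) ∪ ｛ y ′ ｝) ∪ ｛ y ｝) ≐ L (pair x y)

  IsCompleteLattice : Set (suc ℓ)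
  IsCompleteLattice = ∀ (S : Subset) → (∃ λ s → IsSup S s) × (∃ λ i → IsInf S i)

  -- Orthomodular law for a lattice with complementation:
  -- x ∨ y = ((x ∨ y) ∧ y′) ∨ y  (stated for the unique joins/meets)
  OrthomodularLaw : Set ℓ
  OrthomodularLaw = ∀ x y j m k → IsJoin x y j → IsMeet j (y ′) m → IsJoin m y k → j ≡ k

  IsCompleteOrthomodularLattice : Set (suc ℓ)
  IsCompleteOrthomodularLattice = IsCompleteLattice × OrthomodularLaw

  -- Dedekind–MacNeille completion DM(P): the closed subsets B with
  -- L(U(B)) = B, ordered by inclusion (equality = extensional ≐).
  DMClosed : Subset → Set ℓ
  DMClosed B = L (U B) ≐ B

  DM : Set (suc ℓ)
  DM = Σ Subset DMClosed

  _∧DM_ : Subset → Subset → Subset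
  X ∧DM Y = X ∩ Y

  _∨DM_ : Subset → Subset → Subset
  X ∨DM Y = L (U (X ∪ Y))

  _′DM : Subset → Subset
  X ′DM = L (λ z → ∃ λ x → x ∈ X × z ≡ x ′)

  DMOrthomodular : Set (suc ℓ)
  DMOrthomodular = ∀ (X Y : DM) →
    let X₀ = proj₁ X ; Y₀ = proj₁ Y in
    (X₀ ∨DM Y₀) ≐ (((X₀ ∨DM Y₀) ∧DM (Y₀ ′DM)) ∨DM Y₀)

module Submission where

-- Every condition (i)–(iii) is reduced to one order-theoretic
-- property of P, the orthogonality criterion:
--   a ≤ e  whenever no nonzero element of L(U(a,e)) lies below e′.
-- (i) ⇒ criterion and (iii) ⇒ criterion are direct computations (for (iii)
-- take X = ↓a, Y = ↓e in DM(P)).  Conversely the criterion makes P complete: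
-- by an exhaustion argument (a transfinite Bourbaki–Witt tower adding, one at a
-- time, atoms of L(V) orthogonal to what has been built, joined via
-- orthocompleteness) every set L(V) contains an element s such that no nonzero
-- element of L(V) is below s′; for V = U(S) the criterion shows that s = sup S.
-- Finally, in any orthomodular poset the lattice orthomodular law holds where
-- the joins and meets exist, existing meets make P pseudo-orthomodular, and for
-- complete P the operations of DM(P) are computed by those of P, so DM(P)
-- inherits orthomodularity.  Excluded middle is used for case distinctions and
-- to resize propositions from level suc ℓ to level ℓ.

open import Defs
open import Level using (suc; Lift; lift)
open import Data.Product using (_×_; _,_; proj₁; proj₂; Σ; ∃)
open import Data.Sum using (_⊎_; inj₁; inj₂)
open import Data.Empty using (⊥; ⊥-elim)
open import Relation.Nullary using (¬_; Dec; yes; no)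
open import Relation.Nullary.Decidable using (True; toWitness; fromWitness)
open import Relation.Binary.PropositionalEquality using (_≡_; _≢_; refl; sym; subst)
open import Relation.Binary.Structures using (IsPartialOrder)
open import Relation.Unary using (_∈_; _⊆_; _≐_; _∪_; _∩_; ｛_｝)
open import Relation.Unary.Properties using (≐-refl; ≐-sym; ≐-trans)
open import Function.Bundles using (_⇔_; mk⇔)
open import Axiom.ExcludedMiddle using (ExcludedMiddle)

module Classical {ℓ} (lem : ExcludedMiddle (suc ℓ)) where

  decide : (A : Set ℓ) → Dec A
  decide A with lem {Lift (suc ℓ) A}
  ... | yes (lift a) = yes a
  ... | no ¬a = no (λ a → ¬a (lift a))

  Resize : Set (suc ℓ) → Set ℓ
  Resize A = Lift ℓ (True (lem {A}))

  resize : ∀ {A} → A → Resize A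
  resize a = lift (fromWitness a)

  unresize : ∀ {A} → Resize A → A
  unresize (lift t) = toWitness t

module Theory {ℓ} (P : PosetWithComplementation ℓ) where
  open PosetWithComplementation P
  open IsPartialOrder isPartialOrder using ()
    renaming (refl to ≤-refl; trans to ≤-trans; antisym to ≤-antisym)

  transposeʳ : ∀ {x y} → x ≤ y ′ → y ≤ x ′
  transposeʳ {x} {y} p = subst (_≤ x ′) (involutive y) (antitone p)

  transposeˡ : ∀ {x y} → x ′ ≤ y → y ′ ≤ x
  transposeˡ {x} {y} p = subst (y ′ ≤_) (involutive x) (antitone p)

  reflect : ∀ {x y} → x ′ ≤ y ′ → y ≤ x
  reflect {x} {y} p = subst (y ≤_) (involutive x) (transposeʳ p)

  pair-upper : ∀ {a b u} → a ≤ u → b ≤ u → u ∈ U P (pair P a b)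
  pair-upper a≤u b≤u _ (inj₁ refl) = a≤u
  pair-upper a≤u b≤u _ (inj₂ refl) = b≤u

  pair-lower : ∀ {a b l} → l ≤ a → l ≤ b → l ∈ L P (pair P a b)
  pair-lower l≤a l≤b _ (inj₁ refl) = l≤a
  pair-lower l≤a l≤b _ (inj₂ refl) = l≤b

  join-left : ∀ {a b j} → IsJoin P a b j → a ≤ j
  join-left (j-upper , _) = j-upper _ (inj₁ refl)

  join-right : ∀ {a b j} → IsJoin P a b j → b ≤ j
  join-right (j-upper , _) = j-upper _ (inj₂ refl)

  join-least : ∀ {a b j u} → IsJoin P a b j → a ≤ u → b ≤ u → j ≤ u
  join-least (_ , least) a≤u b≤u = least _ (pair-upper a≤u b≤u)

  meet-left : ∀ {a b m} → IsMeet P a b m → m ≤ a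
  meet-left (m-lower , _) = m-lower _ (inj₁ refl)

  meet-right : ∀ {a b m} → IsMeet P a b m → m ≤ b
  meet-right (m-lower , _) = m-lower _ (inj₂ refl)

  meet-greatest : ∀ {a b m l} → IsMeet P a b m → l ≤ a → l ≤ b → l ≤ m
  meet-greatest (_ , greatest) l≤a l≤b = greatest _ (pair-lower l≤a l≤b)

  join-comm : ∀ {a b j} → IsJoin P a b j → IsJoin P b a j
  join-comm j-join =
    pair-upper (join-right j-join) (join-left j-join) ,
    λ u u∈U → join-least j-join (u∈U _ (inj₂ refl)) (u∈U _ (inj₁ refl))

  meet-dual : ∀ {a b m} → IsMeet P a b m → IsJoin P (a ′) (b ′) (m ′)
  meet-dual m-meet =
    pair-upper (antitone (meet-left m-meet)) (antitone (meet-right m-meet)) ,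
    λ v v∈U → transposeˡ (meet-greatest m-meet (transposeˡ (v∈U _ (inj₁ refl)))
                                                (transposeˡ (v∈U _ (inj₂ refl))))

  -- a lattice is complete as soon as all suprema exist (infima are suprema of lower bounds)
  suprema⇒complete : (∀ S → ∃ (IsSup P S)) → IsCompleteLattice P
  suprema⇒complete sup S =
    sup S ,
    (proj₁ (sup (L P S)) ,
     (λ t t∈S → proj₂ (proj₂ (sup (L P S))) t (λ l l∈L → l∈L t t∈S)) ,
     (λ l l∈L → proj₁ (proj₂ (sup (L P S))) l l∈L))

  ↓_ : Carrier → Subset P
  ↓ a = λ z → z ≤ a

  principal-sup : ∀ {A : Subset P} {m} → A ≐ ↓ m → IsSup P A m
  principal-sup (A⊆↓m , ↓m⊆A) = (λ t t∈A → A⊆↓m t∈A) , (λ u u∈U → u∈U _ (↓m⊆A ≤-refl))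

  sup-closure : ∀ {A : Subset P} {s} → IsSup P A s → L P (U P A) ≐ ↓ s
  sup-closure (s-upper , s-least) =
    (λ z∈LU → z∈LU _ s-upper) , (λ z≤s u u∈U → ≤-trans z≤s (s-least u u∈U))

  ↓-closed : ∀ a → DMClosed P (↓ a)
  ↓-closed a = sup-closure (principal-sup ≐-refl)

  complement-closure : ∀ {Y : Subset P} {y} → IsSup P Y y → _′DM P Y ≐ ↓ (y ′)
  complement-closure {Y} {y} (y-upper , y-least) = into , back
    where
    into : _′DM P Y ⊆ ↓ (y ′)
    into {z} z∈Y′ = transposeʳ (y-least (z ′) (λ w w∈Y → transposeʳ (z∈Y′ (w ′) (w , w∈Y , refl))))
    back : ↓ (y ′) ⊆ _′DM P Y
    back z≤y′ _ (w , w∈Y , refl) = ≤-trans z≤y′ (antitone (y-upper w w∈Y))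

  meet-closure : ∀ {A B : Subset P} {a b m} → A ≐ ↓ a → B ≐ ↓ b → IsMeet P a b m → (A ∩ B) ≐ ↓ m
  meet-closure (A⊆ , ⊆A) (B⊆ , ⊆B) m-meet =
    (λ { (t∈A , t∈B) → meet-greatest m-meet (A⊆ t∈A) (B⊆ t∈B) }) ,
    (λ t≤m → ⊆A (≤-trans t≤m (meet-left m-meet)) , ⊆B (≤-trans t≤m (meet-right m-meet)))

  sup-∪ : ∀ {X Y : Subset P} {x y j} → IsSup P X x → IsSup P Y y → IsJoin P x y j → IsSup P (X ∪ Y) j
  sup-∪ (x-upper , x-least) (y-upper , y-least) j-join =
    (λ { t (inj₁ t∈X) → ≤-trans (x-upper t t∈X) (join-left j-join)
       ; t (inj₂ t∈Y) → ≤-trans (y-upper t t∈Y) (join-right j-join) }) ,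
    λ u u∈U → join-least j-join (x-least u (λ t t∈X → u∈U t (inj₁ t∈X)))
                                (y-least u (λ t t∈Y → u∈U t (inj₂ t∈Y)))

  OrthoTrivial : Subset P → Carrier → Set ℓ
  OrthoTrivial M e = ∀ z → z ∈ M → z ≤ e ′ → z ≡ 𝟘

  OrthogonalityCriterion : Set ℓ
  OrthogonalityCriterion = ∀ a e → OrthoTrivial (L P (U P (pair P a e))) e → a ≤ e

  -- (i) ⇒ criterion: apply pseudo-orthomodularity to a′, e′ and test it at e′
  pseudo-orthomodular⇒criterion : PseudoOrthomodular P → OrthogonalityCriterion
  pseudo-orthomodular⇒criterion pom a e trivial =
    reflect (proj₁ (pom (a ′) (e ′)) e′-lower (a ′) (inj₁ refl))
    where
    e′-lower : e ′ ∈ L P (U P (L P (pair P (a ′) (e ′)) ∪ ｛ e ′ ′ ｝) ∪ ｛ e ′ ｝)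
    e′-lower t (inj₂ e′≡t) = subst (e ′ ≤_) e′≡t ≤-refl
    e′-lower t (inj₁ t∈U) = transposeˡ (subst (_≤ e) (sym t′≡𝟘) (𝟘-least e))
      where
      e≤t : e ≤ t
      e≤t = subst (_≤ t) (involutive e) (t∈U (e ′ ′) (inj₂ refl))
      -- t′ lies below every upper bound v of {a, e}, since v′ ∈ L(a′, e′)
      t′∈LU : t ′ ∈ L P (U P (pair P a e))
      t′∈LU v v∈U = transposeˡ (t∈U (v ′) (inj₁ (pair-lower (antitone (v∈U a (inj₁ refl)))
                                                            (antitone (v∈U e (inj₂ refl))))))
      t′≡𝟘 : t ′ ≡ 𝟘
      t′≡𝟘 = trivial (t ′) t′∈LU (antitone e≤t)

  -- (iii) ⇒ criterion: the orthomodular law of DM(P) for X = ↓a, Y = ↓e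
  dm-orthomodular⇒criterion : DMOrthomodular P → OrthogonalityCriterion
  dm-orthomodular⇒criterion dm a e trivial =
    proj₁ (dm (↓ a , ↓-closed a) (↓ e , ↓-closed e)) (λ u u∈U → u∈U a (inj₁ ≤-refl)) e e-upper
    where
    upper-pair⇒upper-∪ : ∀ {v} → v ∈ U P (pair P a e) → v ∈ U P (↓ a ∪ ↓ e)
    upper-pair⇒upper-∪ v∈U w (inj₁ w≤a) = ≤-trans w≤a (v∈U a (inj₁ refl))
    upper-pair⇒upper-∪ v∈U w (inj₂ w≤e) = ≤-trans w≤e (v∈U e (inj₂ refl))
    e-upper : e ∈ U P ((L P (U P (↓ a ∪ ↓ e)) ∩ _′DM P (↓ e)) ∪ ↓ e)
    e-upper t (inj₂ t≤e) = t≤e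
    e-upper t (inj₁ (t∈LU , t∈e′)) = subst (_≤ e) (sym t≡𝟘) (𝟘-least e)
      where
      t≡𝟘 : t ≡ 𝟘
      t≡𝟘 = trivial t (λ v v∈U → t∈LU v (upper-pair⇒upper-∪ v∈U)) (t∈e′ (e ′) (e , ≤-refl , refl))

  module _ (omp : IsOrthomodularPoset P) where

    orthogonal-join : ∀ x y → x ≤ y ′ → ∃ (IsJoin P x y)
    orthogonal-join = proj₁ omp

    orthomodular-identity : ∀ x y → x ≤ y → ∀ m j → IsJoin P (y ′) x m → IsJoin P x (m ′) j → y ≡ j
    orthomodular-identity = proj₂ omp

    orthomodular-law : OrthomodularLaw P
    orthomodular-law x y j m k j-join m-meet k-join =
      orthomodular-identity y j (join-right j-join) (m ′) k
        (subst (λ t → IsJoin P (j ′) t (m ′)) (involutive y) (meet-dual m-meet))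
        (subst (λ t → IsJoin P y t k) (sym (involutive m)) (join-comm k-join))

    relative-meet : ∀ {m y k} → m ≤ y → IsJoin P m (y ′) k → IsMeet P y k m
    relative-meet {m} {y} {k} m≤y k-join = pair-lower m≤y (join-left k-join) , greatest
      where
      j-join : ∃ (IsJoin P (y ′) (k ′))
      j-join = orthogonal-join (y ′) (k ′) (subst (y ′ ≤_) (sym (involutive k)) (join-right k-join))
      -- the orthomodular identity for y′ ≤ m′ gives m′ = y′ ∨ k′
      m′≡y′∨k′ : m ′ ≡ proj₁ j-join
      m′≡y′∨k′ = orthomodular-identity (y ′) (m ′) (antitone m≤y) k (proj₁ j-join)
        (subst (λ t → IsJoin P t (y ′) k) (sym (involutive m)) k-join) (proj₂ j-join)
      greatest : ∀ l → l ∈ L P (pair P y k) → l ≤ m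
      greatest l l∈L = reflect (subst (_≤ l ′) (sym m′≡y′∨k′)
        (join-least (proj₂ j-join) (antitone (l∈L y (inj₁ refl))) (antitone (l∈L k (inj₂ refl)))))

    meets⇒pseudo-orthomodular : (∀ x y → ∃ (IsMeet P x y)) → PseudoOrthomodular P
    meets⇒pseudo-orthomodular meet x y = shrink , expand
      where
      m : Carrier
      m = proj₁ (meet x y)
      m-meet : IsMeet P x y m
      m-meet = proj₂ (meet x y)
      k-join : ∃ (IsJoin P m (y ′))
      k-join = orthogonal-join m (y ′) (subst (m ≤_) (sym (involutive y)) (meet-right m-meet))
      k-upper : proj₁ k-join ∈ U P (L P (pair P x y) ∪ ｛ y ′ ｝)
      k-upper t (inj₁ t∈L) = ≤-trans (proj₂ m-meet t t∈L) (join-left (proj₂ k-join))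
      k-upper t (inj₂ y′≡t) = subst (_≤ proj₁ k-join) y′≡t (join-right (proj₂ k-join))
      shrink : L P (U P (L P (pair P x y) ∪ ｛ y ′ ｝) ∪ ｛ y ｝) ⊆ L P (pair P x y)
      shrink z∈L t t∈pair = ≤-trans
        (meet-greatest (relative-meet (meet-right m-meet) (proj₂ k-join))
                       (z∈L y (inj₂ refl)) (z∈L _ (inj₁ k-upper)))
        (proj₁ m-meet t t∈pair)
      expand : L P (pair P x y) ⊆ L P (U P (L P (pair P x y) ∪ ｛ y ′ ｝) ∪ ｛ y ｝)
      expand z∈L t (inj₁ t∈U) = t∈U _ (inj₁ z∈L)
      expand z∈L t (inj₂ y≡t) = subst (_ ≤_) y≡t (z∈L y (inj₂ refl))

    -- (ii) ⇒ (iii): in a complete P, DM-joins, meets and complements are principal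
    complete⇒dm-orthomodular : IsCompleteLattice P → DMOrthomodular P
    complete⇒dm-orthomodular complete (X , _) (Y , _) =
      ≐-trans (sup-closure j-sup) (subst (λ t → ↓ t ≐ L P (U P (M ∪ Y))) (sym j≡k) (≐-sym (sup-closure k-sup)))
      where
      sup : Subset P → Carrier
      sup A = proj₁ (proj₁ (complete A))
      sup-is : ∀ A → IsSup P A (sup A)
      sup-is A = proj₂ (proj₁ (complete A))
      inf : Subset P → Carrier
      inf A = proj₁ (proj₂ (complete A))
      inf-is : ∀ A → IsInf P A (inf A)
      inf-is A = proj₂ (proj₂ (complete A))
      x y j m k : Carrier
      x = sup X
      y = sup Y
      j = sup (pair P x y)
      m = inf (pair P j (y ′))
      k = sup (pair P m y)
      M : Subset P
      M = L P (U P (X ∪ Y)) ∩ _′DM P Y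
      j-sup : IsSup P (X ∪ Y) j
      j-sup = sup-∪ (sup-is X) (sup-is Y) (sup-is _)
      k-sup : IsSup P (M ∪ Y) k
      k-sup = sup-∪ (principal-sup (meet-closure (sup-closure j-sup) (complement-closure (sup-is Y)) (inf-is _)))
                    (sup-is Y) (sup-is _)
      j≡k : j ≡ k
      j≡k = orthomodular-law x y j m k (sup-is _) (inf-is _) (sup-is _)

  module _ (lem : ExcludedMiddle (suc ℓ)) where
    open Classical lem

    -- Bourbaki–Witt: the least family containing 𝟘 and closed under an inflationary
    -- map f and under all existing suprema is a chain
    module BourbakiWitt (f : Carrier → Carrier) (f-inflationary : ∀ x → x ≤ f x) where

      data Tower : Carrier → Set (suc ℓ) where
        base : Tower 𝟘
        step : ∀ {c} → Tower c → Tower (f c)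
        lim  : (Q : Subset P) → (∀ {x} → x ∈ Q → Tower x) → ∀ {s} → IsSup P Q s → Tower s

      Extreme : Carrier → Set (suc ℓ)
      Extreme c = ∀ {x} → Tower x → x ≤ c → x ≢ c → f x ≤ c

      extreme-splits : ∀ {c} → Extreme c → ∀ {x} → Tower x → (x ≤ c) ⊎ (f c ≤ x)
      extreme-splits {c} ext base = inj₁ (𝟘-least c)
      extreme-splits {c} ext (step {x} t) with extreme-splits ext t
      ... | inj₂ fc≤x = inj₂ (≤-trans fc≤x (f-inflationary x))
      ... | inj₁ x≤c with decide (x ≡ c)
      ...   | yes refl = inj₂ ≤-refl
      ...   | no x≢c = inj₁ (ext t x≤c x≢c)
      extreme-splits {c} ext (lim Q tower s-sup) with decide (Σ Carrier λ q → q ∈ Q × f c ≤ q)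
      ... | yes (q , q∈Q , fc≤q) = inj₂ (≤-trans fc≤q (proj₁ s-sup q q∈Q))
      ... | no none = inj₁ (proj₂ s-sup c below)
        where
        below : ∀ q → q ∈ Q → q ≤ c
        below q q∈Q with extreme-splits ext (tower q∈Q)
        ... | inj₁ q≤c = q≤c
        ... | inj₂ fc≤q = ⊥-elim (none (q , q∈Q , fc≤q))

      tower-extreme : ∀ {c} → Tower c → Extreme c
      tower-extreme base {x} _ x≤𝟘 x≢𝟘 = ⊥-elim (x≢𝟘 (≤-antisym x≤𝟘 (𝟘-least x)))
      tower-extreme (step {c} tc) {x} tx x≤fc x≢fc with extreme-splits (tower-extreme tc) tx
      ... | inj₂ fc≤x = ⊥-elim (x≢fc (≤-antisym x≤fc fc≤x))
      ... | inj₁ x≤c with decide (x ≡ c)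
      ...   | yes refl = ≤-refl
      ...   | no x≢c = ≤-trans (tower-extreme tc tx x≤c x≢c) (f-inflationary c)
      tower-extreme (lim Q tower s-sup) {x} tx x≤s x≢s with decide (Σ Carrier λ q → q ∈ Q × ¬ (q ≤ x))
      ... | yes (q , q∈Q , q≰x) = beyond (extreme-splits (tower-extreme (tower q∈Q)) tx)
        where
        beyond : (x ≤ q) ⊎ (f q ≤ x) → f x ≤ _
        beyond (inj₁ x≤q) = ≤-trans (tower-extreme (tower q∈Q) tx x≤q (λ { refl → q≰x ≤-refl }))
                                    (proj₁ s-sup q q∈Q)
        beyond (inj₂ fq≤x) = ⊥-elim (q≰x (≤-trans (f-inflationary q) fq≤x))
      ... | no none = ⊥-elim (x≢s (≤-antisym x≤s (proj₂ s-sup x below)))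
        where
        below : ∀ q → q ∈ Q → q ≤ x
        below q q∈Q with decide (q ≤ x)
        ... | yes q≤x = q≤x
        ... | no q≰x = ⊥-elim (none (q , q∈Q , q≰x))

      tower-comparable : ∀ {x y} → Tower x → Tower y → (x ≤ y) ⊎ (f y ≤ x)
      tower-comparable tx ty = extreme-splits (tower-extreme ty) tx

    -- exhaustion of L(V): grow an element of L(V) by adjoining orthogonal atoms of L(V)
    -- until none is left
    module Exhaustion (omp : IsOrthomodularPoset P) (oc : Orthocomplete P) (atm : Atomic P)
                      (V : Subset P) where

      D : Subset P
      D = L P V

      Extension : Carrier → Set ℓ
      Extension c = Σ Carrier λ a → IsAtom P a × a ∈ D × a ≤ c ′

      grow : (c : Carrier) → Dec (Extension c) → Carrier
      grow c (yes (a , _ , _ , a≤c′)) = proj₁ (orthogonal-join omp c a (transposeʳ a≤c′))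
      grow c (no _) = c

      Added : (c : Carrier) → Dec (Extension c) → Carrier → Set ℓ
      Added c (yes (a , _)) b = a ≡ b
      Added c (no _) _ = Lift ℓ ⊥

      grow-inflationary : ∀ {c} d → c ≤ grow c d
      grow-inflationary {c} (yes (a , _ , _ , a≤c′)) =
        join-left (proj₂ (orthogonal-join omp c a (transposeʳ a≤c′)))
      grow-inflationary (no _) = ≤-refl

      added-below : ∀ {c a} d → Added c d a → a ≤ grow c d
      added-below {c} (yes (a , _ , _ , a≤c′)) refl =
        join-right (proj₂ (orthogonal-join omp c a (transposeʳ a≤c′)))

      added-extends : ∀ {c a} d → Added c d a → IsAtom P a × a ∈ D × a ≤ c ′
      added-extends (yes (_ , extension)) refl = extension

      added-unique : ∀ {c a b} d → Added c d a → Added c d b → a ≡ b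
      added-unique (yes _) refl refl = refl

      grow-least : ∀ {c u} d → c ≤ u → (∀ {a} → Added c d a → a ≤ u) → grow c d ≤ u
      grow-least {c} (yes (a , _ , _ , a≤c′)) c≤u added≤u =
        join-least (proj₂ (orthogonal-join omp c a (transposeʳ a≤c′))) c≤u (added≤u refl)
      grow-least (no _) c≤u _ = c≤u

      grow-in-D : ∀ {c} d → c ∈ D → grow c d ∈ D
      grow-in-D d c∈D v v∈V = grow-least d (c∈D v v∈V) (λ added → proj₁ (proj₂ (added-extends d added)) v v∈V)

      stalled : ∀ {c} d → grow c d ≤ c → ¬ Extension c
      stalled {c} (yes e@(a , a-atom , _ , a≤c′)) grow≤c _ =
        proj₂ (proj₁ a-atom) (sym (lower-compl c a (≤-trans (added-below (yes e) refl) grow≤c) a≤c′))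
      stalled (no no-extension) _ = no-extension

      next : Carrier → Carrier
      next c = grow c (decide (Extension c))

      AddedAt : Carrier → Carrier → Set ℓ
      AddedAt c = Added c (decide (Extension c))

      open BourbakiWitt next (λ c → grow-inflationary (decide (Extension c)))

      tower-in-D : ∀ {x} → Tower x → x ∈ D
      tower-in-D base v _ = 𝟘-least v
      tower-in-D (step {c} t) = grow-in-D (decide (Extension c)) (tower-in-D t)
      tower-in-D (lim Q tower s-sup) v v∈V = proj₂ s-sup v (λ q q∈Q → tower-in-D (tower q∈Q) v v∈V)

      -- atoms adjoined along the tower are orthogonal, as the tower is a chain
      added-orthogonal : ∀ {a b c d} → Tower c → AddedAt c a → Tower d → AddedAt d b → a ≢ b → a ≤ b ′
      added-orthogonal {c = c} {d} tc a-added td b-added a≢b with tower-comparable tc td | tower-comparable td tc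
      ... | _ | inj₂ next-c≤d =
        ≤-trans (≤-trans (added-below (decide (Extension c)) a-added) next-c≤d)
                (transposeʳ (proj₂ (proj₂ (added-extends (decide (Extension d)) b-added))))
      ... | inj₂ next-d≤c | _ = transposeʳ
        (≤-trans (≤-trans (added-below (decide (Extension d)) b-added) next-d≤c)
                 (transposeʳ (proj₂ (proj₂ (added-extends (decide (Extension c)) a-added)))))
      ... | inj₁ c≤d | inj₁ d≤c with ≤-antisym c≤d d≤c
      ...   | refl = ⊥-elim (a≢b (added-unique (decide (Extension c)) a-added b-added))

      AddedAtoms : Subset P
      AddedAtoms a = Resize (Σ Carrier λ c → Tower c × AddedAt c a)

      added-atoms-sup : ∃ (IsSup P AddedAtoms)
      added-atoms-sup = oc AddedAtoms orthogonal
        where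
        orthogonal : Orthogonal P AddedAtoms
        orthogonal _ _ a∈ b∈ a≢b with unresize a∈ | unresize b∈
        ... | (c , tc , a-added) | (d , td , b-added) = added-orthogonal tc a-added td b-added a≢b

      s : Carrier
      s = proj₁ added-atoms-sup

      tower-below : ∀ {x} → Tower x → x ≤ s
      tower-below base = 𝟘-least s
      tower-below (step {c} t) = grow-least (decide (Extension c)) (tower-below t)
        (λ a-added → proj₁ (proj₂ added-atoms-sup) _ (resize (c , t , a-added)))
      tower-below (lim Q tower s-sup) = proj₂ s-sup s (λ q q∈Q → tower-below (tower q∈Q))

      TowerSet : Subset P
      TowerSet x = Resize (Tower x)

      -- s is the supremum of the whole tower, hence itself a tower element
      tower-sup : IsSup P TowerSet s
      tower-sup = (λ x x∈T → tower-below (unresize x∈T)) ,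
        λ u u∈U → proj₂ (proj₂ added-atoms-sup) u (λ a a∈ → added≤ u u∈U (unresize a∈))
        where
        added≤ : ∀ u → u ∈ U P TowerSet → ∀ {a} → Σ Carrier (λ c → Tower c × AddedAt c a) → a ≤ u
        added≤ u u∈U (c , tc , a-added) =
          ≤-trans (added-below (decide (Extension c)) a-added) (u∈U (next c) (resize (step tc)))

      s-tower : Tower s
      s-tower = lim TowerSet unresize tower-sup

      exhaustion : ∃ λ s → s ∈ D × OrthoTrivial D s
      exhaustion = s , tower-in-D s-tower , trivial
        where
        -- a nonzero z would lie above an atom extending s, but next s ≤ s
        trivial : OrthoTrivial D s
        trivial z z∈D z≤s′ with decide (z ≡ 𝟘)
        ... | yes z≡𝟘 = z≡𝟘
        ... | no z≢𝟘 with atm z (𝟘-least z , λ 𝟘≡z → z≢𝟘 (sym 𝟘≡z))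
        ...   | (a , a-atom , a≤z) =
          ⊥-elim (stalled (decide (Extension s)) (tower-below (step s-tower))
                   (a , a-atom , (λ v v∈V → ≤-trans a≤z (z∈D v v∈V)) , ≤-trans a≤z z≤s′))

    -- criterion ⇒ completeness: the exhaustion element of L(U(S)) is the supremum of S
    criterion⇒suprema : IsOrthomodularPoset P → Orthocomplete P → Atomic P →
                        OrthogonalityCriterion → ∀ S → ∃ (IsSup P S)
    criterion⇒suprema omp oc atm criterion S
      with Exhaustion.exhaustion omp oc atm (U P S)
    ... | c , c∈LU , c-trivial = c , (λ x x∈S → criterion x c (x-trivial x∈S)) , c∈LU
      where
      x-trivial : ∀ {x} → x ∈ S → OrthoTrivial (L P (U P (pair P x c))) c
      x-trivial x∈S z z∈L = c-trivial z (λ u u∈U → z∈L u (pair-upper (u∈U _ x∈S) (c∈LU u u∈U)))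

theorem6 : ∀ {ℓ} → ExcludedMiddle (suc ℓ) → (P : PosetWithComplementation ℓ) →
    IsOrthomodularPoset P → Orthocomplete P → Atomic P →
    (PseudoOrthomodular P ⇔ IsCompleteOrthomodularLattice P)
      × (PseudoOrthomodular P ⇔ DMOrthomodular P)
theorem6 lem P omp oc atm =
  mk⇔ i⇒ii ii⇒i ,
  mk⇔ (λ pom → complete⇒dm-orthomodular omp (proj₁ (i⇒ii pom)))
      (λ dm → ii⇒i (criterion⇒ii (dm-orthomodular⇒criterion dm)))
  where
  open Theory P
  criterion⇒ii : OrthogonalityCriterion → IsCompleteOrthomodularLattice P
  criterion⇒ii criterion =
    suprema⇒complete (criterion⇒suprema lem omp oc atm criterion) , orthomodular-law omp
  i⇒ii : PseudoOrthomodular P → IsCompleteOrthomodularLattice P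
  i⇒ii pom = criterion⇒ii (pseudo-orthomodular⇒criterion pom)
  ii⇒i : IsCompleteOrthomodularLattice P → PseudoOrthomodular P
  ii⇒i (complete , _) = meets⇒pseudo-orthomodular omp (λ x y → proj₂ (complete (pair P x y)))
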